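{- Let $R$ be a commutative ring with identity, $n\in\mathbb{Z}^+$, $R[t]=R[t_1,\ldots,t_n]$. For $1\le i\le n$ let $X_i\subseteq R$ be finite and nonempty with $a_i=\#X_i$, let $\varphi_i(t_i)=\prod_{x\in X_i}(t_i-x)$, and let $\Phi=\langle\varphi_1,\ldots,\varphi_n\rangle$. Let $d=(a_1-1,\ldots,a_n-1)$ and let $f\in R[t]$ be $d$-topped. Then the coefficient of $t^d=t_1^{a_1-1}\cdots t_n^{a_n-1}$ in $f$ equals the coefficient of $t^d$ in $r_X(f)$.
   Context: A polynomial $g\in R[t]$ is $X$-reduced if $\deg_{t_i}g<a_i$ for all $i$. For every $f\in R[t]$ there is a unique $X$-reduced polynomial $r_X(f)$ with $f-r_X(f)\in\Phi$ (the $X$-reduced representative of $f$). For $d=(d_1,\ldots,d_n)\in\mathbb{N}^n$, a polynomial $f$ is $d$-topped if for every $e=(e_1,\ldots,e_n)\in\mathbb{N}^n$ with $d_i\le e_i$ for all $i$ and $\sum_i d_i<\sum_i e_i$, the coefficient of $t_1^{e_1}\cdots t_n^{e_n}$ in $f$ is $0$. -}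

module Defs where

import Level
open import Algebra.Bundles using (CommutativeRing)
open import Data.Nat as ℕ using (ℕ; zero; suc; _∸_; _≤_; _<_)
open import Data.Fin using (Fin)
open import Data.Vec as Vec using (Vec; lookup; zipWith; replicate; _[_]≔_)
open import Data.Vec.Properties using (≡-dec)
open import Data.List as List using (List; []; _∷_; _++_; map; concatMap; foldr; length; allFin)
open import Data.List.Relation.Unary.AllPairs using (AllPairs)
open import Data.Product using (_×_; _,_; ∃)
open import Relation.Nullary using (¬_; yes; no)

-- A polynomial is represented as a finite formal sum of terms  a · t^e
-- (a list of (coefficient, exponent vector) pairs); the coefficient of t^e
-- is the sum of the coefficients of all terms with exponent e.
module Polynomials {c ℓ} (R : CommutativeRing c ℓ) (n : ℕ) where
  open CommutativeRing R renaming (Carrier to A)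

  Monomial : Set
  Monomial = Vec ℕ n

  Poly : Set c
  Poly = List (A × Monomial)

  coeff : Poly → Monomial → A
  coeff [] e = 0#
  coeff ((a , m) ∷ p) e with ≡-dec ℕ._≟_ m e
  ... | yes _ = a + coeff p e
  ... | no _ = coeff p e

  _≈ₚ_ : Poly → Poly → Set ℓ
  p ≈ₚ q = ∀ e → coeff p e ≈ coeff q e

  _⊕_ : Poly → Poly → Poly
  p ⊕ q = p ++ q

  ⊖_ : Poly → Poly
  ⊖ p = map (λ { (a , m) → (- a , m) }) p

  _⊗_ : Poly → Poly → Poly
  p ⊗ q = concatMap (λ { (a , m) → map (λ { (b , k) → (a * b , zipWith ℕ._+_ m k) }) q }) p

  const : A → Poly
  const a = (a , replicate n 0) ∷ []

  var : Fin n → Poly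
  var i = (1# , (replicate n 0 [ i ]≔ 1)) ∷ []

  prodP : List Poly → Poly
  prodP = foldr _⊗_ (const 1#)

  sumP : List Poly → Poly
  sumP = foldr _⊕_ []

  -- finite sets X_i ⊆ R given as lists without repetition (w.r.t. ≈)
  Distinct : List A → Set (c Level.⊔ ℓ)
  Distinct = AllPairs (λ x y → ¬ (x ≈ y))

  sizes : (Fin n → List A) → Fin n → ℕ
  sizes X i = length (X i)

  φ : (Fin n → List A) → Fin n → Poly
  φ X i = prodP (map (λ x → var i ⊕ (⊖ const x)) (X i))

  InΦ : (Fin n → List A) → Poly → Set (c Level.⊔ ℓ)
  InΦ X h = ∃ λ (g : Fin n → Poly) → h ≈ₚ sumP (map (λ i → g i ⊗ φ X i) (allFin n))

  Reduced : (Fin n → List A) → Poly → Set ℓ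
  Reduced X g = ∀ (e : Monomial) (i : Fin n) → sizes X i ≤ lookup e i → coeff g e ≈ 0#

  dX : (Fin n → List A) → Monomial
  dX X = Vec.tabulate (λ i → sizes X i ∸ 1)

  Topped : Monomial → Poly → Set ℓ
  Topped d f = ∀ (e : Monomial) → (∀ i → lookup d i ≤ lookup e i) →
               Vec.sum d < Vec.sum e → coeff f e ≈ 0#

module Submission where

-- We construct an R-linear
-- functional  p ↦ ⟨w , p⟩ = Σ_e coeff p e · w(e)  on R[t] (a "weight" w on
-- exponent vectors) with three properties:
--   (1) w(d) = 1;
--   (2) w(e) = 0 as soon as e_j < d_j for some coordinate j;
--   (3) ⟨w , g·φ_i⟩ = 0 for every polynomial g and every i, so w kills Φ.
-- The weight is  w(e) = Π_j h_{e_j + 1 − a_j}(X_j),  a product of complete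
-- homogeneous symmetric sums of the X_j (with h_k = 0 for k < 0); property
-- (3) is the recurrence  h_k(Z) = h_{k+1}(x ∷ Z) − x·h_k(x ∷ Z),  applied once
-- for each root x of φ_i.  By (1) and (2), a d-topped f and an X-reduced r
-- both satisfy ⟨w , ·⟩ = (coefficient of t^d): every other exponent either
-- lies below d in some coordinate or has a vanishing coefficient.  By (3),
-- ⟨w , f⟩ = ⟨w , r⟩ since f − r ∈ Φ, which is the theorem.

open import Defs
open import Algebra.Bundles using (CommutativeRing)
open import Data.Nat using (ℕ; _≤_)
open import Data.Fin using (Fin)
open import Data.List using (List; length)

open import Data.Nat as ℕ using (zero; suc; _∸_; _<_; z≤n; s≤s)
import Data.Nat.Properties as ℕP
import Data.Fin as F
import Data.Fin.Properties as FP
open import Data.Vec as Vec using (Vec; lookup; zipWith; replicate; _[_]≔_)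
open import Data.Vec.Properties as VecP using (≡-dec)
open import Data.Vec.Functional using (updateAt; removeAt)
import Data.Vec.Functional.Properties as VecFP
open import Data.List using ([]; _∷_; _++_; map; allFin)
open import Data.Product using (_,_; ∃)
open import Data.Sum using (_⊎_; inj₁; inj₂)
open import Relation.Nullary using (yes; no)
open import Data.Empty using (⊥-elim)
open import Relation.Binary.PropositionalEquality as ≡ using (_≡_; _≢_)

module ExponentOrder where

  _≼_ : ∀ {k} → Vec ℕ k → Vec ℕ k → Set
  u ≼ v = ∀ j → lookup u j ≤ lookup v j

  ≼-tail : ∀ {k a b} {u v : Vec ℕ k} → (a Vec.∷ u) ≼ (b Vec.∷ v) → u ≼ v
  ≼-tail u≼v j = u≼v (F.suc j)

  sum-mono-≤ : ∀ {k} (u v : Vec ℕ k) → u ≼ v → Vec.sum u ≤ Vec.sum v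
  sum-mono-≤ Vec.[] Vec.[] _ = z≤n
  sum-mono-≤ (a Vec.∷ u) (b Vec.∷ v) u≼v = ℕP.+-mono-≤ (u≼v F.zero) (sum-mono-≤ u v (≼-tail u≼v))

  sum-mono-< : ∀ {k} (u v : Vec ℕ k) → u ≼ v → u ≢ v → Vec.sum u < Vec.sum v
  sum-mono-< Vec.[] Vec.[] _ u≢v = ⊥-elim (u≢v ≡.refl)
  sum-mono-< (a Vec.∷ u) (b Vec.∷ v) u≼v u≢v with a ℕ.≟ b
  ... | yes ≡.refl = ℕP.+-monoʳ-< a (sum-mono-< u v (≼-tail u≼v) (λ u≡v → u≢v (≡.cong (a Vec.∷_) u≡v)))
  ... | no a≢b = ℕP.+-mono-<-≤ (ℕP.≤∧≢⇒< (u≼v F.zero) a≢b) (sum-mono-≤ u v (≼-tail u≼v))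

  strict-coordinate : ∀ {k} (u v : Vec ℕ k) → u ≼ v → u ≢ v → ∃ λ j → lookup u j < lookup v j
  strict-coordinate Vec.[] Vec.[] _ u≢v = ⊥-elim (u≢v ≡.refl)
  strict-coordinate (a Vec.∷ u) (b Vec.∷ v) u≼v u≢v with a ℕ.≟ b
  ... | yes ≡.refl with strict-coordinate u v (≼-tail u≼v) (λ u≡v → u≢v (≡.cong (a Vec.∷_) u≡v))
  ...   | j , u<v = F.suc j , u<v
  strict-coordinate (a Vec.∷ u) (b Vec.∷ v) u≼v u≢v | no a≢b = F.zero , ℕP.≤∧≢⇒< (u≼v F.zero) a≢b

  ≼-or-below : ∀ {k} (u v : Vec ℕ k) → u ≼ v ⊎ ∃ λ j → lookup v j < lookup u j
  ≼-or-below {k} u v with FP.all? (λ j → lookup u j ℕ.≤? lookup v j)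
  ... | yes u≼v = inj₁ u≼v
  ... | no u⋠v with FP.¬∀⟶∃¬ k _ (λ j → lookup u j ℕ.≤? lookup v j) u⋠v
  ...   | j , uj≰vj = inj₂ (j , ℕP.≰⇒> uj≰vj)

  lookup-shift : ∀ {k} (m₀ u e : Vec ℕ k) j →
                 lookup (zipWith ℕ._+_ m₀ (zipWith ℕ._+_ u e)) j ≡ lookup u j ℕ.+ lookup (zipWith ℕ._+_ m₀ e) j
  lookup-shift m₀ u e j = begin
    lookup (zipWith ℕ._+_ m₀ (zipWith ℕ._+_ u e)) j ≡⟨ VecP.lookup-zipWith ℕ._+_ j m₀ _ ⟩
    lookup m₀ j ℕ.+ lookup (zipWith ℕ._+_ u e) j    ≡⟨ ≡.cong (lookup m₀ j ℕ.+_) (VecP.lookup-zipWith ℕ._+_ j u e) ⟩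
    lookup m₀ j ℕ.+ (lookup u j ℕ.+ lookup e j)     ≡⟨ x∙yz≈y∙xz (lookup m₀ j) (lookup u j) (lookup e j) ⟩
    lookup u j ℕ.+ (lookup m₀ j ℕ.+ lookup e j)     ≡⟨ ≡.cong (lookup u j ℕ.+_) (VecP.lookup-zipWith ℕ._+_ j m₀ e) ⟨
    lookup u j ℕ.+ lookup (zipWith ℕ._+_ m₀ e) j    ∎
    where
    open ≡.≡-Reasoning
    open import Algebra.Properties.CommutativeSemigroup ℕP.+-commutativeSemigroup using (x∙yz≈y∙xz)

open ExponentOrder

module Development {c ℓ} (R : CommutativeRing c ℓ) (n : ℕ) where
  open Polynomials R n
  open CommutativeRing R renaming (Carrier to A)
  open import Relation.Binary.Reasoning.Setoid setoid public
  open import Algebra.Properties.Ring ring using (-‿distribˡ-*)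
  open import Algebra.Properties.AbelianGroup +-abelianGroup using (⁻¹-∙-comm; ε⁻¹≈ε)
  open import Algebra.Solver.Ring.NaturalCoefficients.Default commutativeSemiring
    using (solve; _:=_; _:+_; _:*_; con)
  open import Algebra.Properties.CommutativeMonoid.Sum *-commutativeMonoid
    using (sum-remove; sum-cong-≋; sum-replicate-zero) renaming (sum to prod)

  difference-zero : ∀ x y → x + - y ≈ 0# → x ≈ y
  difference-zero x y x-y≈0 = begin
    x             ≈⟨ sym (+-identityʳ x) ⟩
    x + 0#        ≈⟨ +-congˡ (sym (-‿inverseˡ y)) ⟩
    x + (- y + y) ≈⟨ sym (+-assoc x (- y) y) ⟩
    (x + - y) + y ≈⟨ +-congʳ x-y≈0 ⟩
    0# + y        ≈⟨ +-identityˡ y ⟩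
    y             ∎

  _+ᵥ_ : Monomial → Monomial → Monomial
  u +ᵥ v = zipWith ℕ._+_ u v

  zero-exponent : Monomial
  zero-exponent = replicate n 0

  unit-exponent : Fin n → Monomial
  unit-exponent i = replicate n 0 [ i ]≔ 1

  pair : (Monomial → A) → Poly → A
  pair w [] = 0#
  pair w ((a , m) ∷ p) = a * w m + pair w p

  pair-cong-weight : ∀ {w w′} → (∀ m → w m ≈ w′ m) → ∀ p → pair w p ≈ pair w′ p
  pair-cong-weight w≈w′ [] = refl
  pair-cong-weight w≈w′ ((a , m) ∷ p) = +-cong (*-congˡ (w≈w′ m)) (pair-cong-weight w≈w′ p)

  pair-zero-weight : ∀ {w} → (∀ m → w m ≈ 0#) → ∀ p → pair w p ≈ 0#
  pair-zero-weight w≈0 [] = refl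
  pair-zero-weight w≈0 ((a , m) ∷ p) = begin
    a * _ + pair _ p ≈⟨ +-cong (*-congˡ (w≈0 m)) (pair-zero-weight w≈0 p) ⟩
    a * 0# + 0#      ≈⟨ +-identityʳ _ ⟩
    a * 0#           ≈⟨ zeroʳ a ⟩
    0#               ∎

  pair-linear-weight : ∀ a u v q → pair (λ k → a * u k + v k) q ≈ a * pair u q + pair v q
  pair-linear-weight a u v [] = solve 1 (λ a → con 0 := a :* con 0 :+ con 0) refl a
  pair-linear-weight a u v ((b , k) ∷ q) = begin
    b * (a * u k + v k) + pair (λ k → a * u k + v k) q
      ≈⟨ +-congˡ (pair-linear-weight a u v q) ⟩
    b * (a * u k + v k) + (a * pair u q + pair v q)
      ≈⟨ solve 6 (λ a b x y X Y → b :* (a :* x :+ y) :+ (a :* X :+ Y)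
                                  := a :* (b :* x :+ X) :+ (b :* y :+ Y)) refl
               a b (u k) (v k) (pair u q) (pair v q) ⟩
    a * (b * u k + pair u q) + (b * v k + pair v q) ∎

  pair-++ : ∀ w p q → pair w (p ++ q) ≈ pair w p + pair w q
  pair-++ w [] q = sym (+-identityˡ _)
  pair-++ w ((a , m) ∷ p) q = trans (+-congˡ (pair-++ w p q)) (sym (+-assoc _ _ _))

  pair-⊖ : ∀ w p → pair w (⊖ p) ≈ - pair w p
  pair-⊖ w [] = sym ε⁻¹≈ε
  pair-⊖ w ((a , m) ∷ p) = begin
    - a * w m + pair w (⊖ p)  ≈⟨ +-cong (sym (-‿distribˡ-* a (w m))) (pair-⊖ w p) ⟩
    - (a * w m) + - pair w p  ≈⟨ ⁻¹-∙-comm (a * w m) (pair w p) ⟩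
    - (a * w m + pair w p)    ∎

  pair-difference : ∀ w p q → pair w (p ⊕ (⊖ q)) ≈ pair w p + - pair w q
  pair-difference w p q = trans (pair-++ w p (⊖ q)) (+-congˡ (pair-⊖ w q))

  pair-term-⊗ : ∀ w a m q →
    pair w (map (λ { (b , k) → (a * b , m +ᵥ k) }) q) ≈ a * pair (λ k → w (m +ᵥ k)) q
  pair-term-⊗ w a m [] = solve 1 (λ a → con 0 := a :* con 0) refl a
  pair-term-⊗ w a m ((b , k) ∷ q) = trans (+-congˡ (pair-term-⊗ w a m q))
    (solve 4 (λ a b x y → a :* b :* x :+ a :* y := a :* (b :* x :+ y)) refl a b (w (m +ᵥ k)) (pair (λ k → w (m +ᵥ k)) q))

  pair-⊗ : ∀ w p q → pair w (p ⊗ q) ≈ pair (λ m → pair (λ k → w (m +ᵥ k)) q) p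
  pair-⊗ w [] q = refl
  pair-⊗ w ((a , m) ∷ p) q = trans (pair-++ w (map (λ { (b , k) → (a * b , m +ᵥ k) }) q) (p ⊗ q)) (+-cong (pair-term-⊗ w a m q) (pair-⊗ w p q))

  pair-swap : ∀ (v : Monomial → Monomial → A) p q →
              pair (λ m → pair (v m) q) p ≈ pair (λ k → pair (λ m → v m k) p) q
  pair-swap v [] q = sym (pair-zero-weight (λ _ → refl) q)
  pair-swap v ((a , m) ∷ p) q =
    trans (+-congˡ (pair-swap v p q)) (sym (pair-linear-weight a (v m) (λ k → pair (λ m′ → v m′ k) p) q))

  pair-⊗′ : ∀ w p q → pair w (p ⊗ q) ≈ pair (λ k → pair (λ m → w (m +ᵥ k)) p) q
  pair-⊗′ w p q = trans (pair-⊗ w p q) (pair-swap (λ m k → w (m +ᵥ k)) p q)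

  coeff-++ : ∀ p q e → coeff (p ++ q) e ≈ coeff p e + coeff q e
  coeff-++ [] q e = sym (+-identityˡ _)
  coeff-++ ((a , m) ∷ p) q e with ≡-dec ℕ._≟_ m e
  ... | yes _ = trans (+-congˡ (coeff-++ p q e)) (sym (+-assoc _ _ _))
  ... | no _ = coeff-++ p q e

  coeff-⊖ : ∀ p e → coeff (⊖ p) e ≈ - coeff p e
  coeff-⊖ [] e = sym ε⁻¹≈ε
  coeff-⊖ ((a , m) ∷ p) e with ≡-dec ℕ._≟_ m e
  ... | yes _ = trans (+-congˡ (coeff-⊖ p e)) (⁻¹-∙-comm a (coeff p e))
  ... | no _ = coeff-⊖ p e

  coeff-head-same : ∀ a m p → coeff ((a , m) ∷ p) m ≈ a + coeff p m
  coeff-head-same a m p with ≡-dec ℕ._≟_ m m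
  ... | yes _ = refl
  ... | no m≢m = ⊥-elim (m≢m ≡.refl)

  coeff-head-other : ∀ a m p e → m ≢ e → coeff ((a , m) ∷ p) e ≈ coeff p e
  coeff-head-other a m p e m≢e with ≡-dec ℕ._≟_ m e
  ... | yes m≡e = ⊥-elim (m≢e m≡e)
  ... | no _ = refl

  remove : Monomial → Poly → Poly
  remove m [] = []
  remove m ((a , k) ∷ p) with ≡-dec ℕ._≟_ k m
  ... | yes _ = remove m p
  ... | no _ = (a , k) ∷ remove m p

  remove-length : ∀ m p → length (remove m p) ≤ length p
  remove-length m [] = z≤n
  remove-length m ((a , k) ∷ p) with ≡-dec ℕ._≟_ k m
  ... | yes _ = ℕP.m≤n⇒m≤1+n (remove-length m p)
  ... | no _ = s≤s (remove-length m p)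

  pair-remove : ∀ w m p → pair w p ≈ coeff p m * w m + pair w (remove m p)
  pair-remove w m [] = sym (trans (+-identityʳ _) (zeroˡ (w m)))
  pair-remove w m ((a , k) ∷ p) with ≡-dec ℕ._≟_ k m
  ... | yes ≡.refl = trans (+-congˡ (pair-remove w k p))
      (solve 4 (λ a x c y → a :* x :+ (c :* x :+ y) := (a :+ c) :* x :+ y) refl a (w k) (coeff p k) _)
  ... | no _ = trans (+-congˡ (pair-remove w m p))
      (solve 4 (λ a x c y → a :* x :+ (c :+ y) := c :+ (a :* x :+ y)) refl a (w k) _ _)

  coeff-remove-same : ∀ m p → coeff (remove m p) m ≈ 0#
  coeff-remove-same m [] = refl
  coeff-remove-same m ((a , k) ∷ p) with ≡-dec ℕ._≟_ k m
  ... | yes _ = coeff-remove-same m p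
  ... | no k≢m = trans (coeff-head-other a k (remove m p) m k≢m) (coeff-remove-same m p)

  coeff-remove-other : ∀ m p e → m ≢ e → coeff (remove m p) e ≈ coeff p e
  coeff-remove-other m [] e m≢e = refl
  coeff-remove-other m ((a , k) ∷ p) e m≢e with ≡-dec ℕ._≟_ k m
  ... | yes ≡.refl = trans (coeff-remove-other k p e m≢e) (sym (coeff-head-other a k p e m≢e))
  ... | no _ with ≡-dec ℕ._≟_ k e
  ...   | yes _ = +-congˡ (coeff-remove-other m p e m≢e)
  ...   | no _ = coeff-remove-other m p e m≢e

  -- Induction on the number of terms, removing
  -- all terms with the exponent of the head at once.
  pair-vanishes : ∀ w p → (∀ e → coeff p e * w e ≈ 0#) → pair w p ≈ 0#
  pair-vanishes w p = bounded (length p) p ℕP.≤-refl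
    where
    bounded : ∀ k p → length p ≤ k → (∀ e → coeff p e * w e ≈ 0#) → pair w p ≈ 0#
    bounded k [] _ _ = refl
    bounded (suc k) ((a , m) ∷ p) (s≤s |p|≤k) vanish = begin
      a * w m + pair w p                                ≈⟨ +-congˡ (pair-remove w m p) ⟩
      a * w m + (coeff p m * w m + pair w (remove m p)) ≈⟨ solve 4 (λ a x c y → a :* x :+ (c :* x :+ y)
                                                              := (a :+ c) :* x :+ y) refl a (w m) (coeff p m) _ ⟩
      (a + coeff p m) * w m + pair w (remove m p)       ≈⟨ +-congʳ (*-congʳ (sym (coeff-head-same a m p))) ⟩
      coeff ((a , m) ∷ p) m * w m + pair w (remove m p) ≈⟨ +-cong (vanish m) (bounded k (remove m p)
                                                              (ℕP.≤-trans (remove-length m p) |p|≤k) vanish-rest) ⟩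
      0# + 0#                                           ≈⟨ +-identityʳ 0# ⟩
      0#                                                ∎
      where
      vanish-rest : ∀ e → coeff (remove m p) e * w e ≈ 0#
      vanish-rest e with ≡-dec ℕ._≟_ m e
      ... | yes ≡.refl = trans (*-congʳ (coeff-remove-same m p)) (zeroˡ _)
      ... | no m≢e = trans (*-congʳ (trans (coeff-remove-other m p e m≢e)
                                            (sym (coeff-head-other a m p e m≢e)))) (vanish e)

  pair-resp-≈ₚ : ∀ w p q → p ≈ₚ q → pair w p ≈ pair w q
  pair-resp-≈ₚ w p q p≈q = difference-zero _ _ (begin
    pair w p + - pair w q ≈⟨ sym (pair-difference w p q) ⟩
    pair w (p ⊕ (⊖ q))    ≈⟨ pair-vanishes w (p ⊕ (⊖ q)) vanish ⟩
    0#                    ∎)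
    where
    vanish : ∀ e → coeff (p ⊕ (⊖ q)) e * w e ≈ 0#
    vanish e = trans (*-congʳ (trans (coeff-++ p (⊖ q) e)
                                 (trans (+-cong (p≈q e) (coeff-⊖ q e)) (-‿inverseʳ _)))) (zeroˡ _)

  pair-concentrated : ∀ w d p → w d ≈ 1# → (∀ e → e ≢ d → coeff p e * w e ≈ 0#) → pair w p ≈ coeff p d
  pair-concentrated w d p wd≈1 invisible = difference-zero _ _ (begin
    pair w p + - c₀                     ≈⟨ +-congˡ (sym -c₀-term) ⟩
    pair w p + pair w ((- c₀ , d) ∷ []) ≈⟨ sym (pair-++ w p ((- c₀ , d) ∷ [])) ⟩
    pair w (p ++ ((- c₀ , d) ∷ []))     ≈⟨ pair-vanishes w (p ++ ((- c₀ , d) ∷ [])) vanish ⟩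
    0#                                  ∎)
    where
    c₀ : A
    c₀ = coeff p d
    -c₀-term : - c₀ * w d + 0# ≈ - c₀
    -c₀-term = trans (+-identityʳ _) (trans (*-congˡ wd≈1) (*-identityʳ _))
    vanish : ∀ e → coeff (p ++ ((- c₀ , d) ∷ [])) e * w e ≈ 0#
    vanish e with ≡-dec ℕ._≟_ d e
    ... | yes ≡.refl = trans (*-congʳ (trans (coeff-++ p _ e) (+-congˡ (coeff-head-same (- c₀) d []))))
                         (trans (*-congʳ (trans (+-congˡ (+-identityʳ _)) (-‿inverseʳ c₀))) (zeroˡ _))
    ... | no d≢e = trans (*-congʳ (trans (coeff-++ p _ e) (+-congˡ (coeff-head-other (- c₀) d [] e d≢e))))
                     (trans (*-congʳ (+-identityʳ _)) (invisible e (λ e≡d → d≢e (≡.sym e≡d))))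

  pair-kills-Φ : ∀ w X h → (∀ g i → pair w (g ⊗ φ X i) ≈ 0#) → InΦ X h → pair w h ≈ 0#
  pair-kills-Φ w X h kills (g , h≈Σ) =
    trans (pair-resp-≈ₚ w h (sumP (map (λ i → g i ⊗ φ X i) (allFin n))) h≈Σ) (pair-sum (allFin n))
    where
    pair-sum : ∀ is → pair w (sumP (map (λ i → g i ⊗ φ X i) is)) ≈ 0#
    pair-sum [] = refl
    pair-sum (i ∷ is) = trans (pair-++ w (g i ⊗ φ X i) _)
                          (trans (+-cong (kills (g i) i) (pair-sum is)) (+-identityʳ 0#))

  -- hs Z k = h_{k − |Z|}(Z), the complete homogeneous symmetric sum of
  -- degree k − |Z| in the elements of Z, and 0 when k < |Z|.
  hs : List A → ℕ → A
  hs [] zero = 1#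
  hs [] (suc k) = 0#
  hs (x ∷ Z) zero = 0#
  hs (x ∷ Z) (suc k) = x * hs (x ∷ Z) k + hs Z k

  hs-below : ∀ Z k → k < length Z → hs Z k ≈ 0#
  hs-below (x ∷ Z) zero _ = refl
  hs-below (x ∷ Z) (suc k) (s≤s k<|Z|) = begin
    x * hs (x ∷ Z) k + hs Z k ≈⟨ +-cong (*-congˡ (hs-below (x ∷ Z) k (ℕP.m≤n⇒m≤1+n k<|Z|))) (hs-below Z k k<|Z|) ⟩
    x * 0# + 0#               ≈⟨ +-identityʳ _ ⟩
    x * 0#                    ≈⟨ zeroʳ x ⟩
    0#                        ∎

  hs-top : ∀ Z → hs Z (length Z) ≈ 1#
  hs-top [] = refl
  hs-top (x ∷ Z) = begin
    x * hs (x ∷ Z) (length Z) + hs Z (length Z) ≈⟨ +-cong (*-congˡ (hs-below (x ∷ Z) (length Z) (ℕP.n<1+n _))) (hs-top Z) ⟩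
    x * 0# + 1#                                 ≈⟨ +-congʳ (zeroʳ x) ⟩
    0# + 1#                                     ≈⟨ +-identityˡ 1# ⟩
    1#                                          ∎

  hs-drop : ∀ x Z k → hs Z k ≈ hs (x ∷ Z) (suc k) + - x * hs (x ∷ Z) k
  hs-drop x Z k = sym (begin
    (x * s + hs Z k) + - x * s    ≈⟨ +-congˡ (sym (-‿distribˡ-* x s)) ⟩
    (x * s + hs Z k) + - (x * s)  ≈⟨ solve 3 (λ a b c → (a :+ b) :+ c := b :+ (a :+ c)) refl (x * s) _ _ ⟩
    hs Z k + (x * s + - (x * s))  ≈⟨ +-congˡ (-‿inverseʳ (x * s)) ⟩
    hs Z k + 0#                   ≈⟨ +-identityʳ _ ⟩
    hs Z k                        ∎)
    where
    s : A
    s = hs (x ∷ Z) k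

  prod-zero : ∀ {k} (F : Fin k → A) i → F i ≈ 0# → prod F ≈ 0#
  prod-zero {suc k} F i Fi≈0 = trans (sum-remove {i = i} F) (trans (*-congʳ Fi≈0) (zeroˡ _))

  prod-one : ∀ {k} (F : Fin k → A) → (∀ j → F j ≈ 1#) → prod F ≈ 1#
  prod-one {k} F F≈1 = trans (sum-cong-≋ F≈1) (sum-replicate-zero k)

  prod-linear : ∀ {k} (F G H : Fin k → A) c i →
                (∀ j → j ≢ i → F j ≈ H j) → (∀ j → j ≢ i → G j ≈ H j) →
                H i ≈ F i + c * G i → prod H ≈ prod F + c * prod G
  prod-linear {suc k} F G H c i F≈H G≈H Hi = begin
    prod H                                  ≈⟨ sum-remove {i = i} H ⟩
    H i * P                                 ≈⟨ *-congʳ Hi ⟩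
    (F i + c * G i) * P                     ≈⟨ solve 4 (λ f g c p → (f :+ c :* g) :* p := f :* p :+ c :* (g :* p))
                                                   refl (F i) (G i) c P ⟩
    F i * P + c * (G i * P)                 ≈⟨ sym (+-cong (rest-same F F≈H) (*-congˡ (rest-same G G≈H))) ⟩
    prod F + c * prod G                     ∎
    where
    P : A
    P = prod (removeAt H i)
    rest-same : ∀ K → (∀ j → j ≢ i → K j ≈ H j) → prod K ≈ K i * P
    rest-same K K≈H = trans (sum-remove {i = i} K)
      (*-congˡ (sum-cong-≋ (λ j → K≈H (F.punchIn i j) (FP.punchInᵢ≢i i j))))

  weight : (Fin n → List A) → Monomial → A
  weight Y e = prod (λ j → hs (Y j) (suc (lookup e j)))

  lookup-unit-same : ∀ i → lookup (unit-exponent i) i ≡ 1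
  lookup-unit-same i = VecP.lookup∘update i (replicate n 0) 1

  lookup-unit-other : ∀ i j → j ≢ i → lookup (unit-exponent i) j ≡ 0
  lookup-unit-other i j j≢i = ≡.trans (VecP.lookup∘update′ j≢i (replicate n 0) 1) (VecP.lookup-replicate j 0)

  root-factor : Fin n → A → Poly
  root-factor i x = var i ⊕ (⊖ const x)

  -- Property (3), one root at a time: against the shifted weight of Y,
  -- multiplying by t_i − x where Y_i = x ∷ Z amounts to deleting x from Y_i.
  pair-root-factor : ∀ Y i x Z → Y i ≡ x ∷ Z → ∀ m₀ k →
    pair (λ m → weight Y (m₀ +ᵥ (m +ᵥ k))) (root-factor i x) ≈ weight (updateAt Y i (λ _ → Z)) (m₀ +ᵥ k)
  pair-root-factor Y i x Z Yi≡x∷Z m₀ k =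
    trans (solve 2 (λ a b → con 1 :* a :+ (b :+ con 0) := a :+ b) refl _ _) (sym (prod-linear F G H (- x) i F≈H G≈H Hi))
    where
    Y′ : Fin n → List A
    Y′ = updateAt Y i (λ _ → Z)
    F G H : Fin n → A
    F j = hs (Y j) (suc (lookup (m₀ +ᵥ (unit-exponent i +ᵥ k)) j))
    G j = hs (Y j) (suc (lookup (m₀ +ᵥ (zero-exponent +ᵥ k)) j))
    H j = hs (Y′ j) (suc (lookup (m₀ +ᵥ k) j))
    F≈H : ∀ j → j ≢ i → F j ≈ H j
    F≈H j j≢i = reflexive (≡.cong₂ (λ Z′ e → hs Z′ (suc e)) (≡.sym (VecFP.updateAt-minimal j i Y j≢i))
                  (≡.trans (lookup-shift m₀ (unit-exponent i) k j) (≡.cong (ℕ._+ lookup (m₀ +ᵥ k) j) (lookup-unit-other i j j≢i))))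
    G≈H : ∀ j → j ≢ i → G j ≈ H j
    G≈H j j≢i = reflexive (≡.cong₂ (λ Z′ e → hs Z′ (suc e)) (≡.sym (VecFP.updateAt-minimal j i Y j≢i))
                  (≡.trans (lookup-shift m₀ zero-exponent k j) (≡.cong (ℕ._+ lookup (m₀ +ᵥ k) j) (VecP.lookup-replicate j 0))))
    Hi : H i ≈ F i + - x * G i
    Hi rewrite VecFP.updateAt-updates i {λ _ → Z} Y | Yi≡x∷Z
             | lookup-shift m₀ (unit-exponent i) k i | lookup-unit-same i
             | lookup-shift m₀ zero-exponent k i | VecP.lookup-replicate {n = n} i 0
             = hs-drop x Z (suc (lookup (m₀ +ᵥ k) i))

  weight-kills-roots : ∀ i Z Y → Y i ≡ Z → ∀ m₀ →
    pair (λ k → weight Y (m₀ +ᵥ k)) (prodP (map (root-factor i) Z)) ≈ 0#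
  weight-kills-roots i [] Y Yi≡[] m₀ =
    trans (+-identityʳ _) (trans (*-identityˡ _) (prod-zero _ i empty-factor))
    where
    empty-factor : hs (Y i) (suc (lookup (m₀ +ᵥ zero-exponent) i)) ≈ 0#
    empty-factor rewrite Yi≡[] = refl
  weight-kills-roots i (x ∷ Z) Y Yi≡x∷Z m₀ = begin
    pair v (root-factor i x ⊗ q)                               ≈⟨ pair-⊗′ v (root-factor i x) q ⟩
    pair (λ k → pair (λ m → v (m +ᵥ k)) (root-factor i x)) q  ≈⟨ pair-cong-weight (pair-root-factor Y i x Z Yi≡x∷Z m₀) q ⟩
    pair (λ k → weight Y′ (m₀ +ᵥ k)) q                         ≈⟨ weight-kills-roots i Z Y′ (VecFP.updateAt-updates i Y) m₀ ⟩
    0#                                                         ∎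
    where
    v : Monomial → A
    v k = weight Y (m₀ +ᵥ k)
    q : Poly
    q = prodP (map (root-factor i) Z)
    Y′ : Fin n → List A
    Y′ = updateAt Y i (λ _ → Z)

  weight-kills-φ : ∀ X g i → pair (weight X) (g ⊗ φ X i) ≈ 0#
  weight-kills-φ X g i = trans (pair-⊗ (weight X) g (φ X i))
    (pair-zero-weight (λ m → weight-kills-roots i (X i) X ≡.refl m) g)

  module AtCorner (X : Fin n → List A) (nonempty : ∀ i → 1 ≤ length (X i)) where
    d : Monomial
    d = dX X

    suc-d : ∀ j → suc (lookup d j) ≡ length (X j)
    suc-d j rewrite VecP.lookup∘tabulate (λ i → sizes X i ∸ 1) j with length (X j) | nonempty j
    ... | suc a | _ = ≡.refl

    weight-at-d : weight X d ≈ 1#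
    weight-at-d = prod-one _ (λ j → ≡.subst (λ k → hs (X j) k ≈ 1#) (≡.sym (suc-d j)) (hs-top (X j)))

    weight-below-d : ∀ e j → lookup e j < lookup d j → weight X e ≈ 0#
    weight-below-d e j e<d = prod-zero _ j (hs-below (X j) _ (≡.subst (suc (lookup e j) <_) (suc-d j) (s≤s e<d)))

    pair-topped : ∀ f → Topped d f → pair (weight X) f ≈ coeff f d
    pair-topped f topped = pair-concentrated (weight X) d f weight-at-d invisible
      where
      invisible : ∀ e → e ≢ d → coeff f e * weight X e ≈ 0#
      invisible e e≢d with ≼-or-below d e
      ... | inj₁ d≼e = trans (*-congʳ (topped e d≼e (sum-mono-< d e d≼e (λ d≡e → e≢d (≡.sym d≡e))))) (zeroˡ _)
      ... | inj₂ (j , e<d) = trans (*-congˡ (weight-below-d e j e<d)) (zeroʳ _)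

    pair-reduced : ∀ r → Reduced X r → pair (weight X) r ≈ coeff r d
    pair-reduced r reduced = pair-concentrated (weight X) d r weight-at-d invisible
      where
      invisible : ∀ e → e ≢ d → coeff r e * weight X e ≈ 0#
      invisible e e≢d with ≼-or-below d e
      ... | inj₁ d≼e with strict-coordinate d e d≼e (λ d≡e → e≢d (≡.sym d≡e))
      ...   | j , d<e = trans (*-congʳ (reduced e j (≡.subst (_≤ lookup e j) (suc-d j) d<e))) (zeroˡ _)
      invisible e e≢d | inj₂ (j , e<d) = trans (*-congˡ (weight-below-d e j e<d)) (zeroʳ _)

lemma15 : ∀ {c ℓ} (R : CommutativeRing c ℓ) (n : ℕ) → 1 ≤ n →
    (X : Fin n → List (CommutativeRing.Carrier R)) →
    (∀ i → 1 ≤ length (X i)) →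
    (∀ i → Polynomials.Distinct R n (X i)) →
    let open Polynomials R n in
    (f r : Poly) → Topped (dX X) f →
    Reduced X r → InΦ X (f ⊕ (⊖ r)) →
    CommutativeRing._≈_ R (coeff f (dX X)) (coeff r (dX X))
lemma15 R n _ X nonempty _ f r topped reduced f-r∈Φ = begin
  coeff f d         ≈⟨ sym (pair-topped f topped) ⟩
  pair (weight X) f ≈⟨ difference-zero _ _ f-r-invisible ⟩
  pair (weight X) r ≈⟨ pair-reduced r reduced ⟩
  coeff r d         ∎
  where
  open CommutativeRing R using (_+_; -_; 0#; _≈_; sym; trans)
  open Polynomials R n using (coeff; _⊕_; ⊖_)
  open Development R n
  open AtCorner X nonempty
  f-r-invisible : pair (weight X) f + - pair (weight X) r ≈ 0#
  f-r-invisible = trans (sym (pair-difference (weight X) f r))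
                        (pair-kills-Φ (weight X) X (f ⊕ (⊖ r)) (weight-kills-φ X) f-r∈Φ)
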